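{- The class of MI-lattices is closed under linear sums: if $P$ and $Q$ are disjoint finite MI-lattices, then their linear sum is an MI-lattice.
   Context: The linear (ordinal) sum of disjoint ordered sets $P$ and $Q$ is the order on $P\cup Q$ whose restrictions to $P$ and $Q$ are the given orders and in which every element of $P$ is below every element of $Q$. An MI-ordering of an antichain $\mathcal{A}$ in a lattice $L$ is a listing $a_1,\ldots,a_t$ of the elements of $\mathcal{A}$ such that (i) $a_i\lor a_{i+1}\lor\cdots\lor a_k=a_i\lor a_k$ for all $1\le i<k\le t$, and (ii) $(a_1\land\cdots\land a_k)\lor a_{k+1}=a_k\lor a_{k+1}$ for all $1<k<t$. An MI-lattice is a lattice all of whose antichains have an MI-ordering. -}

module Defs where

open import Data.Product using (Σ; ∃; _×_; _,_)
open import Data.Sum using (_⊎_; inj₁; inj₂)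
open import Data.List using (List; []; _∷_; _++_; foldr)
open import Data.List.Membership.Propositional using (_∈_)
open import Data.List.Relation.Unary.AllPairs using (AllPairs)
open import Data.List.Relation.Binary.Permutation.Propositional using (_↭_)
open import Relation.Binary.PropositionalEquality using (_≡_)
open import Relation.Binary.Lattice.Structures using (IsLattice)
open import Relation.Nullary using (¬_)

module _ {A : Set} (_≤_ : A → A → Set) where

  IsAntichain : List A → Set
  IsAntichain = AllPairs (λ a b → ¬ (a ≤ b) × ¬ (b ≤ a))

module _ {A : Set} (_∨_ _∧_ : A → A → A) where

  -- MI-ordering condition on a listing a₁,…,a_t.
  -- (i)  for i < k :  aᵢ ∨ aᵢ₊₁ ∨ ⋯ ∨ a_k = aᵢ ∨ a_k
  --      (aᵢ = a, aᵢ₊₁ … a_{k-1} = mid, a_k = b)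
  -- (ii) for 1 < k < t : (a₁ ∧ ⋯ ∧ a_k) ∨ a_{k+1} = a_k ∨ a_{k+1}
  --      (a₁ = a1, a₂ … a_{k-1} = mid, a_k = ak, a_{k+1} = ak1)
  record IsMIOrdering (ys : List A) : Set where
    field
      cond-i  : ∀ pre a mid b suf → ys ≡ pre ++ (a ∷ mid ++ (b ∷ suf)) →
                foldr _∨_ b (a ∷ mid) ≡ a ∨ b
      cond-ii : ∀ a1 mid ak ak1 suf → ys ≡ a1 ∷ (mid ++ (ak ∷ ak1 ∷ suf)) →
                foldr _∧_ ak (a1 ∷ mid) ∨ ak1 ≡ ak ∨ ak1

module _ {A : Set} (_≤_ : A → A → Set) (_∨_ _∧_ : A → A → A) where

  record IsMILattice : Set₁ where
    field
      isLattice : IsLattice _≡_ _≤_ _∨_ _∧_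
      mi        : ∀ xs → IsAntichain _≤_ xs →
                  Σ (List A) (λ ys → ys ↭ xs × IsMIOrdering _∨_ _∧_ ys)


IsFinite : Set → Set
IsFinite A = Σ (List A) (λ xs → ∀ x → x ∈ xs)

module _ {A B : Set} where

  data LinSum≤ (_≤₁_ : A → A → Set) (_≤₂_ : B → B → Set) : A ⊎ B → A ⊎ B → Set where
    in₁≤in₁ : ∀ {x y} → x ≤₁ y → LinSum≤ _≤₁_ _≤₂_ (inj₁ x) (inj₁ y)
    in₂≤in₂ : ∀ {x y} → x ≤₂ y → LinSum≤ _≤₁_ _≤₂_ (inj₂ x) (inj₂ y)
    in₁≤in₂ : ∀ {x y} → LinSum≤ _≤₁_ _≤₂_ (inj₁ x) (inj₂ y)

  linSum∨ : (A → A → A) → (B → B → B) → A ⊎ B → A ⊎ B → A ⊎ B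
  linSum∨ _∨₁_ _∨₂_ (inj₁ x) (inj₁ y) = inj₁ (x ∨₁ y)
  linSum∨ _∨₁_ _∨₂_ (inj₁ x) (inj₂ y) = inj₂ y
  linSum∨ _∨₁_ _∨₂_ (inj₂ x) (inj₁ y) = inj₂ x
  linSum∨ _∨₁_ _∨₂_ (inj₂ x) (inj₂ y) = inj₂ (x ∨₂ y)

  linSum∧ : (A → A → A) → (B → B → B) → A ⊎ B → A ⊎ B → A ⊎ B
  linSum∧ _∧₁_ _∧₂_ (inj₁ x) (inj₁ y) = inj₁ (x ∧₁ y)
  linSum∧ _∧₁_ _∧₂_ (inj₁ x) (inj₂ y) = inj₁ x
  linSum∧ _∧₁_ _∧₂_ (inj₂ x) (inj₁ y) = inj₁ y
  linSum∧ _∧₁_ _∧₂_ (inj₂ x) (inj₂ y) = inj₂ (x ∧₂ y)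

-- In the linear sum every element of P lies below every element of Q, so an
-- antichain of P ⊕ Q lies entirely inside one summand, where it is an antichain
-- of that summand. The embeddings of the summands preserve joins and meets, so
-- they carry MI-orderings of P and of Q to MI-orderings of P ⊕ Q.
module Submission where

open import Defs
open import Data.Sum using (_⊎_; inj₁; inj₂)
open import Data.Product using (Σ; ∃₂; _×_; _,_)
open import Data.List using (List; []; _∷_; _++_; foldr; map)
open import Data.List.Properties using (∷-injectiveˡ; ∷-injectiveʳ; foldr-fusion; foldr-map)
open import Data.List.Relation.Unary.All using (_∷_)
open import Data.List.Relation.Unary.AllPairs using (_∷_)
import Data.List.Relation.Unary.AllPairs as AllPairs
import Data.List.Relation.Unary.AllPairs.Properties as AllPairs
open import Data.List.Relation.Binary.Permutation.Propositional using (_↭_)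
import Data.List.Relation.Binary.Permutation.Propositional.Properties as ↭
open import Relation.Binary.PropositionalEquality
open import Relation.Binary.Definitions using (Reflexive)
open import Relation.Binary.Structures using (IsPartialOrder)
open import Relation.Binary.Lattice.Definitions using (Supremum; Infimum)
open import Relation.Binary.Lattice.Structures using (IsLattice)
open import Data.Empty using (⊥-elim)

module _ {A C : Set} (f : A → C) where

  map-≡-∷⁻ : ∀ xs {y ys} → map f xs ≡ y ∷ ys →
             ∃₂ λ x xs′ → xs ≡ x ∷ xs′ × y ≡ f x × map f xs′ ≡ ys
  map-≡-∷⁻ (x ∷ xs) refl = x , xs , refl , refl , refl

  map-≡-++⁻ : ∀ xs ys {zs} → map f xs ≡ ys ++ zs →
              ∃₂ λ ys′ zs′ → xs ≡ ys′ ++ zs′ × ys ≡ map f ys′ × map f zs′ ≡ zs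
  map-≡-++⁻ xs       []       eq = [] , xs , refl , refl , eq
  map-≡-++⁻ (x ∷ xs) (y ∷ ys) eq with map-≡-++⁻ xs ys (∷-injectiveʳ eq)
  ... | ys′ , zs′ , refl , refl , eq′ =
    x ∷ ys′ , zs′ , refl , cong (_∷ map f ys′) (sym (∷-injectiveˡ eq)) , eq′

  foldr-homomorphic : {_•_ : A → A → A} {_∘_ : C → C → C} →
                      (∀ x y → f (x • y) ≡ f x ∘ f y) →
                      ∀ b xs → f (foldr _•_ b xs) ≡ foldr _∘_ (f b) (map f xs)
  foldr-homomorphic {_∘_ = _∘_} hom b xs =
    trans (foldr-fusion f b hom xs) (sym (foldr-map _∘_ f (f b) xs))

module _ {A C : Set} {_∨₁_ _∧₁_ : A → A → A} {_∨_ _∧_ : C → C → C} (f : A → C)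
  (f-∨ : ∀ x y → f (x ∨₁ y) ≡ f x ∨ f y)
  (f-∧ : ∀ x y → f (x ∧₁ y) ≡ f x ∧ f y) where

  IsMIOrdering-map : ∀ ys → IsMIOrdering _∨₁_ _∧₁_ ys → IsMIOrdering _∨_ _∧_ (map f ys)
  IsMIOrdering-map ys mi = record { cond-i = cond-i′ ; cond-ii = cond-ii′ }
    where
    open IsMIOrdering mi
    open ≡-Reasoning

    cond-i′ : ∀ pre a mid b suf → map f ys ≡ pre ++ (a ∷ mid ++ (b ∷ suf)) →
              foldr _∨_ b (a ∷ mid) ≡ a ∨ b
    cond-i′ pre a mid b suf eq with map-≡-++⁻ f ys pre eq
    ... | pre′ , rest , ys≡ , refl , eq₁ with map-≡-∷⁻ f rest eq₁
    ... | a′ , rest₁ , refl , refl , eq₂ with map-≡-++⁻ f rest₁ mid eq₂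
    ... | mid′ , rest₂ , refl , refl , eq₃ with map-≡-∷⁻ f rest₂ eq₃
    ... | b′ , suf′ , refl , refl , _ = begin
      foldr _∨_ (f b′) (map f (a′ ∷ mid′)) ≡⟨ foldr-homomorphic f {_∨₁_} {_∨_} f-∨ b′ (a′ ∷ mid′) ⟨
      f (foldr _∨₁_ b′ (a′ ∷ mid′))        ≡⟨ cong f (cond-i pre′ a′ mid′ b′ suf′ ys≡) ⟩
      f (a′ ∨₁ b′)                         ≡⟨ f-∨ a′ b′ ⟩
      f a′ ∨ f b′                          ∎

    cond-ii′ : ∀ a1 mid ak ak1 suf → map f ys ≡ a1 ∷ (mid ++ (ak ∷ ak1 ∷ suf)) →
               foldr _∧_ ak (a1 ∷ mid) ∨ ak1 ≡ ak ∨ ak1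
    cond-ii′ a1 mid ak ak1 suf eq with map-≡-∷⁻ f ys eq
    ... | a1′ , rest , ys≡ , refl , eq₁ with map-≡-++⁻ f rest mid eq₁
    ... | mid′ , rest₁ , refl , refl , eq₂ with map-≡-∷⁻ f rest₁ eq₂
    ... | ak′ , rest₂ , refl , refl , eq₃ with map-≡-∷⁻ f rest₂ eq₃
    ... | ak1′ , suf′ , refl , refl , _ = begin
      foldr _∧_ (f ak′) (map f (a1′ ∷ mid′)) ∨ f ak1′
        ≡⟨ cong (_∨ f ak1′) (foldr-homomorphic f {_∧₁_} {_∧_} f-∧ ak′ (a1′ ∷ mid′)) ⟨
      f (foldr _∧₁_ ak′ (a1′ ∷ mid′)) ∨ f ak1′
        ≡⟨ f-∨ _ ak1′ ⟨
      f (foldr _∧₁_ ak′ (a1′ ∷ mid′) ∨₁ ak1′)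
        ≡⟨ cong f (cond-ii a1′ mid′ ak′ ak1′ suf′ ys≡) ⟩
      f (ak′ ∨₁ ak1′)
        ≡⟨ f-∨ ak′ ak1′ ⟩
      f ak′ ∨ f ak1′ ∎

IsAntichain-map⁻ : {A C : Set} {_≤₁_ : A → A → Set} {_≤_ : C → C → Set} (f : A → C) →
                   (∀ {x y} → x ≤₁ y → f x ≤ f y) →
                   ∀ {xs} → IsAntichain _≤_ (map f xs) → IsAntichain _≤₁_ xs
IsAntichain-map⁻ f mono anti =
  AllPairs.map (λ (x≰y , y≰x) → (λ x≤y → x≰y (mono x≤y)) , (λ y≤x → y≰x (mono y≤x)))
               (AllPairs.map⁻ anti)

HasMIOrdering : {C : Set} → (C → C → C) → (C → C → C) → List C → Set
HasMIOrdering _∨_ _∧_ xs = Σ (List _) λ ys → ys ↭ xs × IsMIOrdering _∨_ _∧_ ys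

image-hasMIOrdering : {A C : Set} {_≤₁_ : A → A → Set} {_∨₁_ _∧₁_ : A → A → A}
                      {_≤_ : C → C → Set} {_∨_ _∧_ : C → C → C} →
                      IsMILattice _≤₁_ _∨₁_ _∧₁_ → (f : A → C) →
                      (∀ {x y} → x ≤₁ y → f x ≤ f y) →
                      (∀ x y → f (x ∨₁ y) ≡ f x ∨ f y) →
                      (∀ x y → f (x ∧₁ y) ≡ f x ∧ f y) →
                      ∀ xs → IsAntichain _≤_ (map f xs) → HasMIOrdering _∨_ _∧_ (map f xs)
image-hasMIOrdering L f mono f-∨ f-∧ xs anti
  with IsMILattice.mi L xs (IsAntichain-map⁻ f mono anti)
... | ys , ys↭xs , mi = map f ys , ↭.map⁺ f ys↭xs , IsMIOrdering-map f f-∨ f-∧ ys mi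

module _ {A B : Set} {_≤₁_ : A → A → Set} {_≤₂_ : B → B → Set} where

  private
    _≤_ = LinSum≤ _≤₁_ _≤₂_

  linSum-isPartialOrder : IsPartialOrder _≡_ _≤₁_ → IsPartialOrder _≡_ _≤₂_ →
                          IsPartialOrder _≡_ _≤_
  linSum-isPartialOrder P Q = record
    { isPreorder = record
      { isEquivalence = isEquivalence
      ; reflexive     = λ { {inj₁ _} refl → in₁≤in₁ (P.reflexive refl)
                          ; {inj₂ _} refl → in₂≤in₂ (Q.reflexive refl) }
      ; trans         = ≤-trans
      }
    ; antisym = ≤-antisym
    }
    where
    module P = IsPartialOrder P
    module Q = IsPartialOrder Q

    ≤-trans : ∀ {x y z} → x ≤ y → y ≤ z → x ≤ z
    ≤-trans (in₁≤in₁ p) (in₁≤in₁ q) = in₁≤in₁ (P.trans p q)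
    ≤-trans (in₁≤in₁ _) in₁≤in₂     = in₁≤in₂
    ≤-trans (in₂≤in₂ p) (in₂≤in₂ q) = in₂≤in₂ (Q.trans p q)
    ≤-trans in₁≤in₂     (in₂≤in₂ _) = in₁≤in₂

    ≤-antisym : ∀ {x y} → x ≤ y → y ≤ x → x ≡ y
    ≤-antisym (in₁≤in₁ p) (in₁≤in₁ q) = cong inj₁ (P.antisym p q)
    ≤-antisym (in₂≤in₂ p) (in₂≤in₂ q) = cong inj₂ (Q.antisym p q)

  linSum-supremum : {_∨₁_ : A → A → A} {_∨₂_ : B → B → B} → Reflexive _≤₂_ →
                    Supremum _≤₁_ _∨₁_ → Supremum _≤₂_ _∨₂_ →
                    Supremum _≤_ (linSum∨ _∨₁_ _∨₂_)
  linSum-supremum ≤₂-refl sup₁ sup₂ (inj₁ x) (inj₁ y) with sup₁ x y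
  ... | x≤ , y≤ , least = in₁≤in₁ x≤ , in₁≤in₁ y≤ , λ where
    (inj₁ z) (in₁≤in₁ x≤z) (in₁≤in₁ y≤z) → in₁≤in₁ (least z x≤z y≤z)
    (inj₂ z) _ _ → in₁≤in₂
  linSum-supremum ≤₂-refl sup₁ sup₂ (inj₁ x) (inj₂ y) = in₁≤in₂ , in₂≤in₂ ≤₂-refl , λ _ _ y≤z → y≤z
  linSum-supremum ≤₂-refl sup₁ sup₂ (inj₂ x) (inj₁ y) = in₂≤in₂ ≤₂-refl , in₁≤in₂ , λ _ x≤z _ → x≤z
  linSum-supremum ≤₂-refl sup₁ sup₂ (inj₂ x) (inj₂ y) with sup₂ x y
  ... | x≤ , y≤ , least = in₂≤in₂ x≤ , in₂≤in₂ y≤ , λ where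
    (inj₂ z) (in₂≤in₂ x≤z) (in₂≤in₂ y≤z) → in₂≤in₂ (least z x≤z y≤z)

  linSum-infimum : {_∧₁_ : A → A → A} {_∧₂_ : B → B → B} → Reflexive _≤₁_ →
                   Infimum _≤₁_ _∧₁_ → Infimum _≤₂_ _∧₂_ →
                   Infimum _≤_ (linSum∧ _∧₁_ _∧₂_)
  linSum-infimum ≤₁-refl inf₁ inf₂ (inj₁ x) (inj₁ y) with inf₁ x y
  ... | ≤x , ≤y , greatest = in₁≤in₁ ≤x , in₁≤in₁ ≤y , λ where
    (inj₁ z) (in₁≤in₁ z≤x) (in₁≤in₁ z≤y) → in₁≤in₁ (greatest z z≤x z≤y)
  linSum-infimum ≤₁-refl inf₁ inf₂ (inj₁ x) (inj₂ y) = in₁≤in₁ ≤₁-refl , in₁≤in₂ , λ _ z≤x _ → z≤x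
  linSum-infimum ≤₁-refl inf₁ inf₂ (inj₂ x) (inj₁ y) = in₁≤in₂ , in₁≤in₁ ≤₁-refl , λ _ _ z≤y → z≤y
  linSum-infimum ≤₁-refl inf₁ inf₂ (inj₂ x) (inj₂ y) with inf₂ x y
  ... | ≤x , ≤y , greatest = in₂≤in₂ ≤x , in₂≤in₂ ≤y , λ where
    (inj₁ z) _ _ → in₁≤in₂
    (inj₂ z) (in₂≤in₂ z≤x) (in₂≤in₂ z≤y) → in₂≤in₂ (greatest z z≤x z≤y)

  linSum-isLattice : {_∨₁_ _∧₁_ : A → A → A} {_∨₂_ _∧₂_ : B → B → B} →
                     IsLattice _≡_ _≤₁_ _∨₁_ _∧₁_ → IsLattice _≡_ _≤₂_ _∨₂_ _∧₂_ →
                     IsLattice _≡_ _≤_ (linSum∨ _∨₁_ _∨₂_) (linSum∧ _∧₁_ _∧₂_)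
  linSum-isLattice P Q = record
    { isPartialOrder = linSum-isPartialOrder P.isPartialOrder Q.isPartialOrder
    ; supremum       = linSum-supremum (Q.reflexive refl) P.supremum Q.supremum
    ; infimum        = linSum-infimum (P.reflexive refl) P.infimum Q.infimum
    }
    where
    module P = IsLattice P
    module Q = IsLattice Q

  InOneSummand : List (A ⊎ B) → Set
  InOneSummand xs = (Σ (List A) λ l → xs ≡ map inj₁ l) ⊎ (Σ (List B) λ l → xs ≡ map inj₂ l)

  linSum-antichain-inOneSummand : ∀ xs → IsAntichain _≤_ xs → InOneSummand xs
  linSum-antichain-inOneSummand [] _ = inj₁ ([] , refl)
  linSum-antichain-inOneSummand (x ∷ xs) (x#xs ∷ anti) with x | x#xs | linSum-antichain-inOneSummand xs anti
  ... | inj₁ a | _ | inj₁ (l , refl) = inj₁ (a ∷ l , refl)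
  ... | inj₂ b | _ | inj₂ (l , refl) = inj₂ (b ∷ l , refl)
  ... | inj₁ a | _ | inj₂ ([] , refl) = inj₁ (a ∷ [] , refl)
  ... | inj₂ b | _ | inj₁ ([] , refl) = inj₂ (b ∷ [] , refl)
  ... | inj₁ a | (a≰ , _) ∷ _ | inj₂ (_ ∷ _ , refl) = ⊥-elim (a≰ in₁≤in₂)
  ... | inj₂ b | (_ , ≰b) ∷ _ | inj₁ (_ ∷ _ , refl) = ⊥-elim (≰b in₁≤in₂)

theorem5p2 : {A B : Set} (_≤₁_ : A → A → Set) (_∨₁_ _∧₁_ : A → A → A) (_≤₂_ : B → B → Set) (_∨₂_ _∧₂_ : B → B → B) →
    IsFinite A → IsMILattice _≤₁_ _∨₁_ _∧₁_ →
    IsFinite B → IsMILattice _≤₂_ _∨₂_ _∧₂_ →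
    IsMILattice (LinSum≤ _≤₁_ _≤₂_) (linSum∨ _∨₁_ _∨₂_) (linSum∧ _∧₁_ _∧₂_)
theorem5p2 _ _ _ _ _ _ _ P _ Q = record
  { isLattice = linSum-isLattice (IsMILattice.isLattice P) (IsMILattice.isLattice Q)
  ; mi        = mi
  }
  where
  mi : ∀ xs → IsAntichain (LinSum≤ _ _) xs → HasMIOrdering (linSum∨ _ _) (linSum∧ _ _) xs
  mi xs anti with linSum-antichain-inOneSummand xs anti
  ... | inj₁ (l , refl) = image-hasMIOrdering P inj₁ in₁≤in₁ (λ _ _ → refl) (λ _ _ → refl) l anti
  ... | inj₂ (l , refl) = image-hasMIOrdering Q inj₂ in₂≤in₂ (λ _ _ → refl) (λ _ _ → refl) l anti
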